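{- Let $G = \{G_1, \ldots, G_n\}$ with $n \ge 1$. Assume that $G_1 \equiv \{*L\}$ and that every option $G_j$ ($1 \le j \le n$) is a non-terminal position $G_j = \{G_{j1}, \ldots, G_{jm_j}\}$ having some option $G_{j\ell} \equiv *L$. Then $G \equiv *L$. Similarly, if $G_1 \equiv \{*R\}$ and every option $G_j = \{G_{j1}, \ldots, G_{jm_j}\}$ has some option $G_{j\ell} \equiv *R$, then $G \equiv *R$.
   Context: Positions are defined recursively: $*L$ and $*R$ are terminal positions; if $G_1,\dots,G_n$ ($n\ge 1$) are positions, then $\{G_1,\dots,G_n\}$ is a position with options $G_1,\dots,G_n$. All positions have finite game trees. Play: Left and Right move alternately, each choosing any option of the current position; when a terminal position is reached, Left wins if it is $*L$ and Right wins if it is $*R$. Disjunctive sum: $*L + *L = *R + *R = *L$, $*L + *R = *R + *L = *R$; if at least one of $G,H$ is non-terminal, $G+H$ has options all $G'+H$ ($G'$ an option of $G$) and all $G+H'$ ($H'$ an option of $H$). Outcome classes: $\mathcal{L}$ (Left wins moving first or second), $\mathcal{R}$ (Right wins moving first or second), $\mathcal{N}$ (first player wins), $\mathcal{P}$ (second player wins); $o(G)$ denotes the outcome class. Equivalence: $G \equiv H$ iff $o(G+X) = o(H+X)$ for every position $X$. -}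

module Defs where

open import Data.Bool using (Bool; true; false; _∧_; _∨_)
open import Data.Product using (_×_)
open import Relation.Binary.PropositionalEquality using (_≡_)

mutual
  data Pos : Set where
    *L *R : Pos
    node  : Opts → Pos

  data Opts : Set where
    [_]  : Pos → Opts
    _∷_  : Pos → Opts → Opts

infixr 5 _∷_ _++_

_++_ : Opts → Opts → Opts
[ x ] ++ ys = x ∷ ys
(x ∷ xs) ++ ys = x ∷ (xs ++ ys)

data _∈_ (x : Pos) : Opts → Set where
  here-1 : x ∈ [ x ]
  here   : ∀ {xs} → x ∈ (x ∷ xs)
  there  : ∀ {y xs} → x ∈ xs → x ∈ (y ∷ xs)

infixl 6 _⊕_
mutual
  _⊕_ : Pos → Pos → Pos
  *L ⊕ *L = *L
  *R ⊕ *R = *L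
  *L ⊕ *R = *R
  *R ⊕ *L = *R
  node gs ⊕ *L = node (mapL gs *L)
  node gs ⊕ *R = node (mapL gs *R)
  node gs ⊕ node hs = node (mapL gs (node hs) ++ mapR (node gs) hs)
  *L ⊕ node hs = node (mapR *L hs)
  *R ⊕ node hs = node (mapR *R hs)

  mapL : Opts → Pos → Opts
  mapL [ g ] h = [ g ⊕ h ]
  mapL (g ∷ gs) h = (g ⊕ h) ∷ mapL gs h

  mapR : Pos → Opts → Opts
  mapR g [ h ] = [ g ⊕ h ]
  mapR g (h ∷ hs) = (g ⊕ h) ∷ mapR g hs

-- Play. leftFirst G  = true iff Left wins G when Left moves first;
--       leftSecond G = true iff Left wins G when Right moves first.
-- At a terminal position the game is over: Left wins iff it is *L.
mutual
  leftFirst : Pos → Bool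
  leftFirst *L = true
  leftFirst *R = false
  leftFirst (node gs) = anyLS gs

  leftSecond : Pos → Bool
  leftSecond *L = true
  leftSecond *R = false
  leftSecond (node gs) = allLF gs

  anyLS : Opts → Bool
  anyLS [ g ] = leftSecond g
  anyLS (g ∷ gs) = leftSecond g ∨ anyLS gs

  allLF : Opts → Bool
  allLF [ g ] = leftFirst g
  allLF (g ∷ gs) = leftFirst g ∧ allLF gs

-- Games are finite with no draws, so Right wins moving first iff Left does not win
-- moving second, and Right wins moving second iff Left does not win moving first.
data Outcome : Set where
  𝓛 𝓡 𝓝 𝓟 : Outcome

o : Pos → Outcome
o G with leftFirst G | leftSecond G
... | true  | true  = 𝓛
... | false | false = 𝓡
... | true  | false = 𝓝
... | false | true  = 𝓟

_≡g_ : Pos → Pos → Set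
G ≡g H = ∀ X → o (G ⊕ X) ≡ o (H ⊕ X)

_isOptionOf_ : Pos → Pos → Set
G' isOptionOf *L = Data.Empty.⊥
  where import Data.Empty
G' isOptionOf *R = Data.Empty.⊥
  where import Data.Empty
G' isOptionOf node gs = G' ∈ gs

first : Opts → Pos
first [ g ] = g
first (g ∷ _) = g

{-# OPTIONS --safe #-}
-- Let t be terminal and G = {G₁,…,Gₙ}. By induction on X, G + X and t + X have the same
-- winner moving first and moving second. An opponent's move to Gⱼ + X is answered by
-- Gⱼₗ + X, equivalent to t + X; a move inside X is matched by the same move in the other
-- sum. When X is terminal, t + X has no options, and G₁ + X ≡ {t} + X = {t + X} stands in
-- for it, which has the same winners as the terminal t + X.
module Submission where

open import Defs
open import Data.Bool using (Bool; true; false; T)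
open import Data.Bool.Properties using (T-∨; T-∧)
open import Data.Empty using (⊥-elim)
open import Data.Product using (_×_; ∃; ∃-syntax; _,_; proj₁; proj₂; map₁; map₂)
open import Data.Sum using (_⊎_; inj₁; inj₂) renaming (map to ⊎-map; map₁ to ⊎-map₁)
open import Function using (_∘_)
open import Function.Bundles using (Equivalence)
open import Induction.WellFounded using (WellFounded; WfRec; Acc; acc; module All)
open import Relation.Binary.PropositionalEquality using (_≡_; refl; sym; trans; cong; subst; module ≡-Reasoning)

open Equivalence using (to; from)

T-injective : ∀ {a b} → (T a → T b) → (T b → T a) → a ≡ b
T-injective {false} {false} _ _ = refl
T-injective {false} {true}  _ b⇒a = ⊥-elim (b⇒a _)
T-injective {true}  {false} a⇒b _ = ⊥-elim (a⇒b _)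
T-injective {true}  {true}  _ _ = refl

leftWinsFirst : Outcome → Bool
leftWinsFirst 𝓛 = true
leftWinsFirst 𝓝 = true
leftWinsFirst 𝓡 = false
leftWinsFirst 𝓟 = false

leftWinsSecond : Outcome → Bool
leftWinsSecond 𝓛 = true
leftWinsSecond 𝓟 = true
leftWinsSecond 𝓡 = false
leftWinsSecond 𝓝 = false

leftWinsFirst-o : ∀ G → leftWinsFirst (o G) ≡ leftFirst G
leftWinsFirst-o G with leftFirst G | leftSecond G
... | true  | true  = refl
... | true  | false = refl
... | false | true  = refl
... | false | false = refl

leftWinsSecond-o : ∀ G → leftWinsSecond (o G) ≡ leftSecond G
leftWinsSecond-o G with leftFirst G | leftSecond G
... | true  | true  = refl
... | true  | false = refl
... | false | true  = refl
... | false | false = refl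

SameWinners : Pos → Pos → Set
SameWinners P Q = leftFirst P ≡ leftFirst Q × leftSecond P ≡ leftSecond Q

module _ (P Q : Pos) where
  open ≡-Reasoning

  o-≡⇒SameWinners : o P ≡ o Q → SameWinners P Q
  o-≡⇒SameWinners eq = lf≡ , ls≡
    where
    lf≡ : leftFirst P ≡ leftFirst Q
    lf≡ = begin
      leftFirst P          ≡⟨ sym (leftWinsFirst-o P) ⟩
      leftWinsFirst (o P)  ≡⟨ cong leftWinsFirst eq ⟩
      leftWinsFirst (o Q)  ≡⟨ leftWinsFirst-o Q ⟩
      leftFirst Q          ∎
    ls≡ : leftSecond P ≡ leftSecond Q
    ls≡ = begin
      leftSecond P          ≡⟨ sym (leftWinsSecond-o P) ⟩
      leftWinsSecond (o P)  ≡⟨ cong leftWinsSecond eq ⟩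
      leftWinsSecond (o Q)  ≡⟨ leftWinsSecond-o Q ⟩
      leftSecond Q          ∎

  SameWinners⇒o-≡ : SameWinners P Q → o P ≡ o Q
  SameWinners⇒o-≡ (lf≡ , ls≡) rewrite lf≡ | ls≡ = refl

first∈ : ∀ os → first os ∈ os
first∈ [ x ]   = here-1
first∈ (x ∷ _) = here

∈-++⁺ˡ : ∀ {x xs} ys → x ∈ xs → x ∈ (xs ++ ys)
∈-++⁺ˡ ys here-1     = here
∈-++⁺ˡ ys here       = here
∈-++⁺ˡ ys (there x∈) = there (∈-++⁺ˡ ys x∈)

∈-++⁺ʳ : ∀ {x} xs {ys} → x ∈ ys → x ∈ (xs ++ ys)
∈-++⁺ʳ [ _ ]    x∈ = there x∈
∈-++⁺ʳ (_ ∷ xs) x∈ = there (∈-++⁺ʳ xs x∈)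

∈-++⁻ : ∀ {x} xs ys → x ∈ (xs ++ ys) → x ∈ xs ⊎ x ∈ ys
∈-++⁻ [ _ ]    ys here       = inj₁ here-1
∈-++⁻ [ _ ]    ys (there x∈) = inj₂ x∈
∈-++⁻ (_ ∷ xs) ys here       = inj₁ here
∈-++⁻ (_ ∷ xs) ys (there x∈) = ⊎-map₁ there (∈-++⁻ xs ys x∈)

∈-mapL⁺ : ∀ {g gs} h → g ∈ gs → (g ⊕ h) ∈ mapL gs h
∈-mapL⁺ h here-1     = here-1
∈-mapL⁺ h here       = here
∈-mapL⁺ h (there g∈) = there (∈-mapL⁺ h g∈)

∈-mapL⁻ : ∀ {x} gs h → x ∈ mapL gs h → ∃[ g ] (g ∈ gs × x ≡ g ⊕ h)
∈-mapL⁻ [ g ]    h here-1     = g , here-1 , refl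
∈-mapL⁻ (g ∷ gs) h here       = g , here , refl
∈-mapL⁻ (_ ∷ gs) h (there x∈) = map₂ (map₁ there) (∈-mapL⁻ gs h x∈)

∈-mapR⁺ : ∀ {h hs} g → h ∈ hs → (g ⊕ h) ∈ mapR g hs
∈-mapR⁺ g here-1     = here-1
∈-mapR⁺ g here       = here
∈-mapR⁺ g (there h∈) = there (∈-mapR⁺ g h∈)

∈-mapR⁻ : ∀ {x} g hs → x ∈ mapR g hs → ∃[ h ] (h ∈ hs × x ≡ g ⊕ h)
∈-mapR⁻ g [ h ]    here-1     = h , here-1 , refl
∈-mapR⁻ g (h ∷ hs) here       = h , here , refl
∈-mapR⁻ g (_ ∷ hs) (there x∈) = map₂ (map₁ there) (∈-mapR⁻ g hs x∈)

⊕-optionˡ : ∀ {g} G X → g isOptionOf G → (g ⊕ X) isOptionOf (G ⊕ X)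
⊕-optionˡ (node gs) *L        g∈ = ∈-mapL⁺ *L g∈
⊕-optionˡ (node gs) *R        g∈ = ∈-mapL⁺ *R g∈
⊕-optionˡ (node gs) (node hs) g∈ = ∈-++⁺ˡ _ (∈-mapL⁺ (node hs) g∈)

⊕-optionʳ : ∀ {X'} G X → X' isOptionOf X → (G ⊕ X') isOptionOf (G ⊕ X)
⊕-optionʳ *L        (node hs) X'∈ = ∈-mapR⁺ *L X'∈
⊕-optionʳ *R        (node hs) X'∈ = ∈-mapR⁺ *R X'∈
⊕-optionʳ (node gs) (node hs) X'∈ = ∈-++⁺ʳ (mapL gs (node hs)) (∈-mapR⁺ (node gs) X'∈)

⊕-option⁻ : ∀ {x} G X → x isOptionOf (G ⊕ X) →
  ∃[ g ] (g isOptionOf G × x ≡ g ⊕ X) ⊎ ∃[ X' ] (X' isOptionOf X × x ≡ G ⊕ X')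
⊕-option⁻ *L        (node hs) x∈ = inj₂ (∈-mapR⁻ *L hs x∈)
⊕-option⁻ *R        (node hs) x∈ = inj₂ (∈-mapR⁻ *R hs x∈)
⊕-option⁻ (node gs) *L        x∈ = inj₁ (∈-mapL⁻ gs *L x∈)
⊕-option⁻ (node gs) *R        x∈ = inj₁ (∈-mapL⁻ gs *R x∈)
⊕-option⁻ (node gs) (node hs) x∈ =
  ⊎-map (∈-mapL⁻ gs (node hs)) (∈-mapR⁻ (node gs) hs) (∈-++⁻ (mapL gs (node hs)) _ x∈)

anyLS⁺ : ∀ {x} os → x ∈ os → T (leftSecond x) → T (anyLS os)
anyLS⁺ [ _ ]    here-1     w = w
anyLS⁺ (_ ∷ _)  here       w = from T-∨ (inj₁ w)
anyLS⁺ (_ ∷ os) (there x∈) w = from T-∨ (inj₂ (anyLS⁺ os x∈ w))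

anyLS⁻ : ∀ os → T (anyLS os) → ∃[ x ] (x ∈ os × T (leftSecond x))
anyLS⁻ [ x ]    w = x , here-1 , w
anyLS⁻ (x ∷ os) w with to T-∨ w
... | inj₁ wx  = x , here , wx
... | inj₂ wos = map₂ (map₁ there) (anyLS⁻ os wos)

allLF⁺ : ∀ os → (∀ x → x ∈ os → T (leftFirst x)) → T (allLF os)
allLF⁺ [ x ]    w = w x here-1
allLF⁺ (x ∷ os) w = from T-∧ (w x here , allLF⁺ os (λ y → w y ∘ there))

allLF⁻ : ∀ {x} os → T (allLF os) → x ∈ os → T (leftFirst x)
allLF⁻ [ _ ]    w here-1     = w
allLF⁻ (_ ∷ _)  w here       = proj₁ (to T-∧ w)
allLF⁻ (_ ∷ os) w (there x∈) = allLF⁻ os (proj₂ (to T-∧ w)) x∈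

leftFirst-intro : ∀ {x} p → x isOptionOf p → T (leftSecond x) → T (leftFirst p)
leftFirst-intro (node os) = anyLS⁺ os

-- The option y only witnesses that p is not terminal.
leftFirst-elim : ∀ {y} p → y isOptionOf p → T (leftFirst p) → ∃[ x ] (x isOptionOf p × T (leftSecond x))
leftFirst-elim (node os) _ = anyLS⁻ os

leftSecond-intro : ∀ {y} p → y isOptionOf p → (∀ x → x isOptionOf p → T (leftFirst x)) → T (leftSecond p)
leftSecond-intro (node os) _ = allLF⁺ os

leftSecond-elim : ∀ {x} p → T (leftSecond p) → x isOptionOf p → T (leftFirst x)
leftSecond-elim (node os) = allLF⁻ os

isOptionOf-wellFounded : WellFounded _isOptionOf_
isOptionOf-wellFounded *L        = acc λ ()
isOptionOf-wellFounded *R        = acc λ ()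
isOptionOf-wellFounded (node os) = acc (options-accessible os)
  where
  options-accessible : ∀ os {x} → x ∈ os → Acc _isOptionOf_ x
  options-accessible [ x ]    here-1     = isOptionOf-wellFounded x
  options-accessible (x ∷ _)  here       = isOptionOf-wellFounded x
  options-accessible (_ ∷ os) (there x∈) = options-accessible os x∈

data Terminal : Pos → Set where
  *L : Terminal *L
  *R : Terminal *R

terminal-⊕-option⁻ : ∀ {t x} X → Terminal t → x isOptionOf (t ⊕ X) → ∃[ X' ] (X' isOptionOf X × x ≡ t ⊕ X')
terminal-⊕-option⁻ {t} X t-terminal x∈ with ⊕-option⁻ t X x∈
terminal-⊕-option⁻ X *L _ | inj₁ (_ , () , _)
terminal-⊕-option⁻ X *R _ | inj₁ (_ , () , _)
... | inj₂ X'-option = X'-option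

leftFirst-singleton-⊕ : ∀ {X} p → Terminal X → leftFirst (node [ p ] ⊕ X) ≡ leftSecond (p ⊕ X)
leftFirst-singleton-⊕ p *L = refl
leftFirst-singleton-⊕ p *R = refl

leftSecond-singleton-⊕ : ∀ {X} p → Terminal X → leftSecond (node [ p ] ⊕ X) ≡ leftFirst (p ⊕ X)
leftSecond-singleton-⊕ p *L = refl
leftSecond-singleton-⊕ p *R = refl

leftFirst-via-equivalent-option : ∀ g h → ∃[ g' ] (g' isOptionOf g × g' ≡g h) →
  ∀ X → T (leftSecond (h ⊕ X)) → T (leftFirst (g ⊕ X))
leftFirst-via-equivalent-option g h (g' , g'∈g , g'≡h) X w =
  leftFirst-intro (g ⊕ X) (⊕-optionˡ g X g'∈g) (subst T (sym (proj₂ g'⊕X≈h⊕X)) w)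
  where
  g'⊕X≈h⊕X : SameWinners (g' ⊕ X) (h ⊕ X)
  g'⊕X≈h⊕X = o-≡⇒SameWinners (g' ⊕ X) (h ⊕ X) (g'≡h X)

leftSecond-via-equivalent-option : ∀ g h → ∃[ g' ] (g' isOptionOf g × g' ≡g h) →
  ∀ X → T (leftSecond (g ⊕ X)) → T (leftFirst (h ⊕ X))
leftSecond-via-equivalent-option g h (g' , g'∈g , g'≡h) X w =
  subst T (proj₁ g'⊕X≈h⊕X) (leftSecond-elim (g ⊕ X) w (⊕-optionˡ g X g'∈g))
  where
  g'⊕X≈h⊕X : SameWinners (g' ⊕ X) (h ⊕ X)
  g'⊕X≈h⊕X = o-≡⇒SameWinners (g' ⊕ X) (h ⊕ X) (g'≡h X)

module _ {t gs} (t-terminal : Terminal t) (first≡ : first gs ≡g node [ t ])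
         (reply : ∀ g → g ∈ gs → ∃[ g' ] (g' isOptionOf g × g' ≡g t)) where

  private
    G : Pos
    G = node gs

    Agrees : Pos → Set
    Agrees X = SameWinners (G ⊕ X) (t ⊕ X)

  module _ {X} (X-terminal : Terminal X) where
    private
      first-winners : SameWinners (first gs ⊕ X) (node [ t ] ⊕ X)
      first-winners = o-≡⇒SameWinners (first gs ⊕ X) (node [ t ] ⊕ X) (first≡ X)

    leftFirst-t⊕⇒G⊕-terminal : T (leftFirst (t ⊕ X)) → T (leftFirst (G ⊕ X))
    leftFirst-t⊕⇒G⊕-terminal w =
      leftFirst-intro (G ⊕ X) (⊕-optionˡ G X (first∈ gs))
        (subst T (sym (trans (proj₂ first-winners) (leftSecond-singleton-⊕ t X-terminal))) w)

    leftSecond-G⊕⇒t⊕-terminal : T (leftSecond (G ⊕ X)) → T (leftSecond (t ⊕ X))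
    leftSecond-G⊕⇒t⊕-terminal w =
      subst T (trans (proj₁ first-winners) (leftFirst-singleton-⊕ t X-terminal))
        (leftSecond-elim (G ⊕ X) w (⊕-optionˡ G X (first∈ gs)))

  leftFirst-G⊕⇒t⊕ : ∀ X → WfRec _isOptionOf_ Agrees X → T (leftFirst (G ⊕ X)) → T (leftFirst (t ⊕ X))
  leftFirst-G⊕⇒t⊕ X ih w with leftFirst-elim (G ⊕ X) (⊕-optionˡ G X (first∈ gs)) w
  ... | x , x∈ , wx with ⊕-option⁻ G X x∈
  ... | inj₁ (g , g∈ , refl) = leftSecond-via-equivalent-option g t (reply g g∈) X wx
  ... | inj₂ (X' , X'∈ , refl) =
    leftFirst-intro (t ⊕ X) (⊕-optionʳ t X X'∈) (subst T (proj₂ (ih X'∈)) wx)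

  leftSecond-t⊕⇒G⊕ : ∀ X → WfRec _isOptionOf_ Agrees X → T (leftSecond (t ⊕ X)) → T (leftSecond (G ⊕ X))
  leftSecond-t⊕⇒G⊕ X ih w = leftSecond-intro (G ⊕ X) (⊕-optionˡ G X (first∈ gs)) winning
    where
    winning : ∀ x → x isOptionOf (G ⊕ X) → T (leftFirst x)
    winning x x∈ with ⊕-option⁻ G X x∈
    ... | inj₁ (g , g∈ , refl) = leftFirst-via-equivalent-option g t (reply g g∈) X w
    ... | inj₂ (X' , X'∈ , refl) =
      subst T (sym (proj₁ (ih X'∈))) (leftSecond-elim (t ⊕ X) w (⊕-optionʳ t X X'∈))

  leftFirst-t⊕⇒G⊕ : ∀ X → WfRec _isOptionOf_ Agrees X → T (leftFirst (t ⊕ X)) → T (leftFirst (G ⊕ X))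
  leftFirst-t⊕⇒G⊕ *L _ = leftFirst-t⊕⇒G⊕-terminal *L
  leftFirst-t⊕⇒G⊕ *R _ = leftFirst-t⊕⇒G⊕-terminal *R
  leftFirst-t⊕⇒G⊕ X@(node hs) ih w with leftFirst-elim (t ⊕ X) (⊕-optionʳ t X (first∈ hs)) w
  ... | x , x∈ , wx with terminal-⊕-option⁻ X t-terminal x∈
  ... | X' , X'∈ , refl =
    leftFirst-intro (G ⊕ X) (⊕-optionʳ G X X'∈) (subst T (sym (proj₂ (ih X'∈))) wx)

  leftSecond-G⊕⇒t⊕ : ∀ X → WfRec _isOptionOf_ Agrees X → T (leftSecond (G ⊕ X)) → T (leftSecond (t ⊕ X))
  leftSecond-G⊕⇒t⊕ *L _ = leftSecond-G⊕⇒t⊕-terminal *L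
  leftSecond-G⊕⇒t⊕ *R _ = leftSecond-G⊕⇒t⊕-terminal *R
  leftSecond-G⊕⇒t⊕ X@(node hs) ih w = leftSecond-intro (t ⊕ X) (⊕-optionʳ t X (first∈ hs)) winning
    where
    winning : ∀ x → x isOptionOf (t ⊕ X) → T (leftFirst x)
    winning x x∈ with terminal-⊕-option⁻ X t-terminal x∈
    ... | X' , X'∈ , refl =
      subst T (proj₁ (ih X'∈)) (leftSecond-elim (G ⊕ X) w (⊕-optionʳ G X X'∈))

  node-≡g-terminal : G ≡g t
  node-≡g-terminal X = SameWinners⇒o-≡ (G ⊕ X) (t ⊕ X) (All.wfRec isOptionOf-wellFounded _ Agrees agrees X)
    where
    agrees : ∀ X → WfRec _isOptionOf_ Agrees X → Agrees X
    agrees X ih = T-injective (leftFirst-G⊕⇒t⊕ X ih) (leftFirst-t⊕⇒G⊕ X ih)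
                , T-injective (leftSecond-G⊕⇒t⊕ X ih) (leftSecond-t⊕⇒G⊕ X ih)

theorem3p9 : (gs : Opts) →
    (first gs ≡g node [ *L ] →
      (∀ Gj → Gj ∈ gs → ∃[ Gjl ] (Gjl isOptionOf Gj × Gjl ≡g *L)) →
      node gs ≡g *L)
    × (first gs ≡g node [ *R ] →
      (∀ Gj → Gj ∈ gs → ∃[ Gjl ] (Gjl isOptionOf Gj × Gjl ≡g *R)) →
      node gs ≡g *R)
theorem3p9 gs = node-≡g-terminal *L , node-≡g-terminal *R
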